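{- Let $t$ and $\lambda$ be positive integers with $t\ge \lambda+2$. If $D$ is a $(t,\lambda)$-liking digraph, then $D$ is isomorphic to the complete digraph $\overleftrightarrow{K}_{t+\lambda}$ on $t+\lambda$ vertices. That is, $\overleftrightarrow{K}_{t+\lambda}$ is the only $(t,\lambda)$-liking digraph.
   Context: All digraphs are finite and have no loops and no multiple arcs. For positive integers $t,\lambda$, a digraph $D$ is a $(t,\lambda)$-liking digraph if every set of $t$ distinct vertices of $D$ has exactly $\lambda$ common out-neighbors (the definition presumes $D$ has at least $t$ vertices). The complete digraph $\overleftrightarrow{K}_n$ is the digraph on $n$ vertices in which $x\to y$ and $y\to x$ for every pair of distinct vertices $x,y$. -}

module Defs where

open import Data.Nat using (ℕ; _≤_)
open import Data.Bool using (Bool; true; false; _∧_)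
open import Data.Fin using (Fin)
import Data.Fin
import Data.Vec
import Relation.Nullary
import Relation.Binary.PropositionalEquality
open import Data.Fin.Subset using (Subset; _∈_; ∣_∣)
open import Data.Vec using (tabulate; lookup)
open import Relation.Binary.PropositionalEquality using (_≡_; _≢_)
open import Function.Bundles using (_⤖_; Bijection)
open import Function.Base using (_∘_)
open import Data.Product using (Σ; _×_)

-- A finite digraph (no loops, no multiple arcs) on vertex set Fin n.
-- arc x y ≡ true means x → y.
record Digraph : Set where
  field
    n      : ℕ
    arc    : Fin n → Fin n → Bool
    noLoop : ∀ x → arc x x ≡ false
open Digraph public

commonOut : (D : Digraph) → Subset (n D) → Subset (n D)
commonOut D S = tabulate λ y → allArc y
  where
  go : ∀ {k} → Data.Vec.Vec Bool k → (Fin k → Bool) → Bool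
  go Data.Vec.[] f = true
  go (false Data.Vec.∷ s) f = go s (f ∘ Fin.suc)
  go (true Data.Vec.∷ s) f = f Fin.zero ∧ go s (f ∘ Fin.suc)
  allArc : Fin (n D) → Bool
  allArc y = go S (λ x → arc D x y)

IsLiking : ℕ → ℕ → Digraph → Set
IsLiking t l D =
  (t ≤ n D) × (∀ (S : Subset (n D)) → ∣ S ∣ ≡ t → ∣ commonOut D S ∣ ≡ l)

complete : ℕ → Digraph
complete m = record { n = m ; arc = λ x y → not⌊ x Data.Fin.≟ y ⌋ ; noLoop = λ x → lemma x }
  where
  open import Relation.Nullary.Decidable using (⌊_⌋)
  open import Data.Bool using (not)
  not⌊_⌋ : ∀ {P : Set} → Relation.Nullary.Dec P → Bool
  not⌊ d ⌋ = not ⌊ d ⌋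
  lemma : ∀ x → not⌊ x Data.Fin.≟ x ⌋ ≡ false
  lemma x with x Data.Fin.≟ x
  ... | Relation.Nullary.yes _ = Relation.Binary.PropositionalEquality.refl
  ... | Relation.Nullary.no ¬p = Data.Empty.⊥-elim (¬p Relation.Binary.PropositionalEquality.refl)
    where import Data.Empty

_≅_ : Digraph → Digraph → Set
D ≅ E = Σ (Fin (n D) ⤖ Fin (n E)) λ f →
  ∀ x y → arc D x y ≡ arc E (Bijection.to f x) (Bijection.to f y)

{-# OPTIONS --safe #-}
module Submission where

-- Write t = k + 1. A k-set T has more than l common out-neighbours (one of them, x,
-- is lost when passing to the t-set T ∪ {x}), and an (l+1)-set Y has fewer than t
-- common in-neighbours. Double counting the pairs (T, Y) with Y ⊆ N⁺(T) therefore
-- gives C(|V|, k) ≤ #pairs ≤ C(|V|, l+1), whereas l + 1 ≤ k ≤ |V| - (l + 1) (a t-set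
-- is disjoint from its l common out-neighbours) gives C(|V|, l+1) ≤ C(|V|, k). So
-- every step is tight: |N⁺(T)| = l + 1 for every k-set T, and every (l+1)-set has at
-- least k common in-neighbours. Two vertices x ≠ z lie in such a Y, hence in N⁺(T)
-- for a k-set T; if x ↛ z, then N⁺(T ∪ {x}) ∪ {x, z} would be l + 2 common
-- out-neighbours of T. Thus D is complete, and N⁺(S) = V ∖ S for a t-set S gives
-- |V| = t + l.

open import Defs
open import Data.Nat using (ℕ; _≤_; _+_)
open import Data.Nat using (suc)

open import Data.Bool using (Bool; true; false; _∧_)
open import Data.Bool.Properties using (¬-not)
open import Data.Fin using (Fin; zero; suc; _≟_)
open import Data.Fin.Subset
  using (Subset; inside; outside; _∈_; _∉_; _⊆_; _⊂_; ∁; _∪_; ⁅_⁆; ⊥; ⊤; ∣_∣; Nonempty)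
open import Data.Fin.Subset.Properties
  using ( _⊆?_; ⊥⊆; ⊆⊤; ⊆-refl; s⊆s; out⊆; out⊆-⇔; in⊆in-⇔; p⊆q⇒∣p∣≤∣q∣; p⊂q⇒∣p∣<∣q∣
        ; ∣⊥∣≡0; ∣⊤∣≡n; ∣⁅x⁆∣≡1; x∈⁅x⁆; x∈⁅y⁆⇒x≡y; x≢y⇒x∉⁅y⁆; ∪-identityʳ
        ; p⊆p∪q; q⊆p∪q; x∈p∪q⁻; x∉p⇒x∈∁p; x∈∁p⇒x∉p; ∣∁p∣≡n∸∣p∣; nonempty?; Empty-unique )
open import Data.List using (List; []; _∷_; [_]; _++_; map; length; filter)
open import Data.List.Membership.Propositional using () renaming (_∈_ to _∈ₗ_)
open import Data.List.Membership.Propositional.Properties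
  using (∈-map⁺; ∈-map⁻; ∈-++⁺ˡ; ∈-++⁺ʳ; ∈-++⁻)
open import Data.List.Properties using (filter-++; filter-≐; filter-all; filter-none; length-++)
import Data.List.Relation.Unary.All as All
open import Data.List.Relation.Unary.Any using (here; there)
open import Data.Nat using (zero; _<_; _>_; _∸_; z≤n; s≤s; z<s)
open import Data.Nat.Combinatorics
  using (_C_; nCn≡1; nC1≡n; nCk≡nC[n∸k]; k>n⇒nCk≡0; nCk+nC[k+1]≡[n+1]C[k+1])
open import Data.Nat.ListAction using (sum)
open import Data.Nat.Properties
  using ( ≤-refl; ≤-reflexive; ≤-trans; ≤-antisym; ≤-<-trans; <-irrefl; >⇒≢; <⇒≤; <⇒≱; ≮⇒≥; n≤1+n
        ; m≤n⇒m<n∨m≡n; m≤m+n; n≤0⇒n≡0; m<n⇒0<n∸m; m+[n∸m]≡n; m+n∸m≡n; suc-injective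
        ; +-comm; +-identityʳ; +-mono-≤; +-monoʳ-≤; +-cancelˡ-≤; +-cancelʳ-≤; module ≤-Reasoning
        ; +-commutativeSemigroup )
open import Algebra.Properties.CommutativeSemigroup +-commutativeSemigroup using (x∙yz≈y∙xz)
open import Data.Product using (∃-syntax; _×_; _,_; proj₁; proj₂)
open import Data.Sum using (inj₁; inj₂; [_,_]′)
open import Data.Vec using ([]; _∷_; here; there; lookup; tabulate)
open import Data.Vec.Properties using (lookup∘tabulate; []=⇒lookup; lookup⇒[]=)
open import Function.Base using (_∘_; flip)
open import Function.Bundles using (_⇔_; Equivalence)
open import Function.Construct.Identity using (⤖-id)
open import Level using (Level)
open import Relation.Binary.Core using (REL)
open import Relation.Binary.Definitions using () renaming (Decidable to Decidable₂)
open import Relation.Binary.PropositionalEquality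
  using (_≡_; _≢_; refl; sym; trans; cong; cong₂; subst; module ≡-Reasoning)
open import Relation.Nullary using (yes; no; does; contradiction)
open import Relation.Unary using (Pred; Decidable; _≐_)

private
  variable
    a b ℓ : Level
    A : Set a
    B : Set b
    N j m : ℕ
    p q : Subset N
    x y : Fin N

∣p∪⁅x⁆∣≡1+∣p∣ : x ∉ p → ∣ p ∪ ⁅ x ⁆ ∣ ≡ suc ∣ p ∣
∣p∪⁅x⁆∣≡1+∣p∣ {x = zero}  {p = outside ∷ p} _   = cong (suc ∘ ∣_∣) (∪-identityʳ p)
∣p∪⁅x⁆∣≡1+∣p∣ {x = zero}  {p = inside ∷ p}  x∉p = contradiction here x∉p
∣p∪⁅x⁆∣≡1+∣p∣ {x = suc x} {p = outside ∷ p} x∉p = ∣p∪⁅x⁆∣≡1+∣p∣ (x∉p ∘ there)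
∣p∪⁅x⁆∣≡1+∣p∣ {x = suc x} {p = inside ∷ p}  x∉p = cong suc (∣p∪⁅x⁆∣≡1+∣p∣ (x∉p ∘ there))

p∪⁅y⁆⊂q : p ⊆ q → y ∈ q → x ∈ q → x ∉ p → x ≢ y → p ∪ ⁅ y ⁆ ⊂ q
p∪⁅y⁆⊂q {p = p} {q = q} {y = y} p⊆q y∈q x∈q x∉p x≢y =
  (λ w∈ → [ p⊆q , (λ w∈⁅y⁆ → subst (_∈ q) (sym (x∈⁅y⁆⇒x≡y y w∈⁅y⁆)) y∈q) ]′ (x∈p∪q⁻ p ⁅ y ⁆ w∈)) ,
  _ , x∈q , λ x∈ → [ x∉p , x≢y ∘ x∈⁅y⁆⇒x≡y y ]′ (x∈p∪q⁻ p ⁅ y ⁆ x∈)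

subset-of-size : ∀ (p : Subset N) → j ≤ ∣ p ∣ → ∃[ q ] q ⊆ p × ∣ q ∣ ≡ j
subset-of-size {N = N} {j = zero} _ _ = ⊥ , ⊥⊆ , ∣⊥∣≡0 N
subset-of-size {j = suc j} (inside ∷ p) (s≤s j≤∣p∣) =
  let q , q⊆p , ∣q∣≡j = subset-of-size p j≤∣p∣ in inside ∷ q , s⊆s q⊆p , cong suc ∣q∣≡j
subset-of-size {j = suc j} (outside ∷ p) j<∣p∣ =
  let q , q⊆p , ∣q∣≡j = subset-of-size p j<∣p∣ in outside ∷ q , s⊆s q⊆p , ∣q∣≡j

superset-of-size : ∀ (p : Subset N) → ∣ p ∣ ≤ j → j ≤ N → ∃[ q ] p ⊆ q × ∣ q ∣ ≡ j
superset-of-size [] _ z≤n = [] , ⊆-refl , refl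
superset-of-size (inside ∷ p) (s≤s ∣p∣≤j) (s≤s j≤N) =
  let q , p⊆q , ∣q∣≡j = superset-of-size p ∣p∣≤j j≤N in inside ∷ q , s⊆s p⊆q , cong suc ∣q∣≡j
superset-of-size {j = zero} (outside ∷ p) ∣p∣≤0 _ = outside ∷ p , ⊆-refl , n≤0⇒n≡0 ∣p∣≤0
superset-of-size {j = suc j} (outside ∷ p) ∣p∣≤1+j (s≤s j≤N) with m≤n⇒m<n∨m≡n ∣p∣≤1+j
... | inj₂ ∣p∣≡1+j = outside ∷ p , ⊆-refl , ∣p∣≡1+j
... | inj₁ (s≤s ∣p∣≤j) =
  let q , p⊆q , ∣q∣≡j = superset-of-size p ∣p∣≤j j≤N in inside ∷ q , out⊆ p⊆q , cong suc ∣q∣≡j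

∃-of-size : j ≤ N → ∃[ p ] ∣ p ∣ ≡ j
∃-of-size {N = N} j≤N =
  let p , _ , ∣p∣≡j = superset-of-size ⊥ (≤-trans (≤-reflexive (∣⊥∣≡0 N)) z≤n) j≤N in p , ∣p∣≡j

∣p∣>0⇒nonempty : ∀ {p : Subset N} → ∣ p ∣ > 0 → Nonempty p
∣p∣>0⇒nonempty {N} {p} ∣p∣>0 with nonempty? p
... | yes ne   = ne
... | no empty = contradiction (trans (cong ∣_∣ (Empty-unique empty)) (∣⊥∣≡0 N)) (>⇒≢ ∣p∣>0)

∣p∣<N⇒∃∉ : ∀ {p : Subset N} → ∣ p ∣ < N → ∃[ x ] x ∉ p
∣p∣<N⇒∃∉ {p = p} ∣p∣<N =
  let x , x∈∁p = ∣p∣>0⇒nonempty (subst (0 <_) (sym (∣∁p∣≡n∸∣p∣ p)) (m<n⇒0<n∸m ∣p∣<N))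
  in x , x∈∁p⇒x∉p x∈∁p

k≤n⇒nCk>0 : ∀ {n k} → k ≤ n → n C k > 0
k≤n⇒nCk>0 {k = zero} _ = z<s
k≤n⇒nCk>0 {suc n} {suc k} (s≤s k≤n) =
  subst (_> 0) (nCk+nC[k+1]≡[n+1]C[k+1] n k) (≤-trans (k≤n⇒nCk>0 k≤n) (m≤m+n _ _))

nCk>0⇒k≤n : ∀ {n k} → n C k > 0 → k ≤ n
nCk>0⇒k≤n nCk>0 = ≮⇒≥ λ n<k → <-irrefl (sym (k>n⇒nCk≡0 n<k)) nCk>0

n≤k⇒nCk≤1 : ∀ {n k} → n ≤ k → n C k ≤ 1
n≤k⇒nCk≤1 {k = k} n≤k with m≤n⇒m<n∨m≡n n≤k
... | inj₁ n<k  = ≤-trans (≤-reflexive (k>n⇒nCk≡0 n<k)) z≤n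
... | inj₂ refl = ≤-reflexive (nCn≡1 k)

-- Induction on n via Pascal's rule; when i + j = n the two sides agree by symmetry.
nCi≤nCj : ∀ {n i j} → i ≤ j → i + j ≤ n → n C i ≤ n C j
nCi≤nCj {i = zero} _ j≤n = k≤n⇒nCk>0 j≤n
nCi≤nCj {suc n} {suc i} {suc j} (s≤s i≤j) i+j≤n with m≤n⇒m<n∨m≡n i+j≤n
... | inj₂ i+j≡n = ≤-reflexive (begin
  suc n C suc i                        ≡⟨ nCk≡nC[n∸k] (≤-trans (m≤m+n (suc i) (suc j)) i+j≤n) ⟩
  suc n C (suc n ∸ suc i)              ≡⟨ cong (λ m → suc n C (m ∸ suc i)) (sym i+j≡n) ⟩
  suc n C (suc i + suc j ∸ suc i)      ≡⟨ cong (suc n C_) (m+n∸m≡n (suc i) (suc j)) ⟩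
  suc n C suc j                        ∎)
  where open ≡-Reasoning
... | inj₁ (s≤s 2+i+j≤n) = begin
  suc n C suc i            ≡⟨ nCk+nC[k+1]≡[n+1]C[k+1] n i ⟨
  n C i + n C suc i        ≤⟨ +-mono-≤ (nCi≤nCj i≤j (≤-trans (+-monoʳ-≤ i (n≤1+n j)) (<⇒≤ 2+i+j≤n)))
                                       (nCi≤nCj (s≤s i≤j) 2+i+j≤n) ⟩
  n C j + n C suc j        ≡⟨ nCk+nC[k+1]≡[n+1]C[k+1] n j ⟩
  suc n C suc j            ∎
  where open ≤-Reasoning

nCk≡1⇒n≤k : ∀ {n k} → k > 0 → n C k ≡ 1 → n ≤ k
nCk≡1⇒n≤k {n} {k} k>0 nCk≡1 = ≮⇒≥ λ k<n → <⇒≱ (≤-<-trans k>0 k<n) (begin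
  n       ≡⟨ nC1≡n n ⟨
  n C 1   ≤⟨ nCi≤nCj k>0 k<n ⟩
  n C k   ≡⟨ nCk≡1 ⟩
  1       ∎)
  where open ≤-Reasoning

count : {P : Pred A ℓ} → Decidable P → List A → ℕ
count P? = length ∘ filter P?

module _ {P : Pred A ℓ} (P? : Decidable P) where

  count-++ : ∀ xs ys → count P? (xs ++ ys) ≡ count P? xs + count P? ys
  count-++ xs ys = trans (cong length (filter-++ P? xs ys)) (length-++ (filter P? xs))

  count-map : ∀ (f : B → A) xs → count P? (map f xs) ≡ count (P? ∘ f) xs
  count-map f []       = refl
  count-map f (x ∷ xs) with does (P? (f x))
  ... | true  = cong suc (count-map f xs)
  ... | false = count-map f xs

count-≐ : {P Q : Pred A ℓ} (P? : Decidable P) (Q? : Decidable Q) → P ≐ Q →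
          ∀ xs → count P? xs ≡ count Q? xs
count-≐ P? Q? P≐Q xs = cong length (filter-≐ P? Q? P≐Q xs)

sum-map-one : ∀ (xs : List A) → sum (map (λ _ → 1) xs) ≡ length xs
sum-map-one []       = refl
sum-map-one (_ ∷ xs) = cong suc (sum-map-one xs)

sum-map-mono-≤ : ∀ {xs : List A} {f g : A → ℕ} →
                 (∀ {x} → x ∈ₗ xs → f x ≤ g x) → sum (map f xs) ≤ sum (map g xs)
sum-map-mono-≤ {xs = []}     _   = z≤n
sum-map-mono-≤ {xs = x ∷ xs} f≤g = +-mono-≤ (f≤g (here refl)) (sum-map-mono-≤ (f≤g ∘ there))

sum-map-tight : ∀ {xs : List A} {f g : A → ℕ} → (∀ {x} → x ∈ₗ xs → f x ≤ g x) →
                sum (map g xs) ≤ sum (map f xs) → ∀ {x} → x ∈ₗ xs → f x ≡ g x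
sum-map-tight {xs = x ∷ xs} {f} {g} f≤g Σg≤Σf (here refl) =
  ≤-antisym (f≤g (here refl))
    (+-cancelʳ-≤ _ _ _ (≤-trans Σg≤Σf (+-monoʳ-≤ (f x) (sum-map-mono-≤ (f≤g ∘ there)))))
sum-map-tight {xs = x ∷ xs} {f} {g} f≤g Σg≤Σf (there x∈xs) =
  sum-map-tight (f≤g ∘ there)
    (+-cancelˡ-≤ (g x) _ _ (≤-trans Σg≤Σf (+-mono-≤ (f≤g (here refl)) ≤-refl))) x∈xs

module _ {R : REL A B ℓ} (R? : Decidable₂ R) where

  sum-count-swap : ∀ xs ys →
    sum (map (λ x → count (R? x) ys) xs) ≡ sum (map (λ y → count (flip R? y) xs) ys)
  sum-count-swap [] ys = sym (sum-count-[] ys)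
    where
    sum-count-[] : ∀ zs → sum (map (λ y → count (flip R? y) []) zs) ≡ 0
    sum-count-[] []       = refl
    sum-count-[] (_ ∷ zs) = sum-count-[] zs
  sum-count-swap (x ∷ xs) ys =
    trans (cong (count (R? x) ys +_) (sum-count-swap xs ys)) (sym (sum-count-∷ ys))
    where
    columns : List B → ℕ
    columns zs = sum (map (λ y → count (flip R? y) xs) zs)

    sum-count-∷ : ∀ zs → sum (map (λ y → count (flip R? y) (x ∷ xs)) zs) ≡ count (R? x) zs + columns zs
    sum-count-∷ []       = refl
    sum-count-∷ (y ∷ zs) with does (R? x y)
    ... | true  = cong suc (trans (cong (count (flip R? y) xs +_) (sum-count-∷ zs))
                                  (x∙yz≈y∙xz (count (flip R? y) xs) (count (R? x) zs) (columns zs)))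
    ... | false = trans (cong (count (flip R? y) xs +_) (sum-count-∷ zs))
                        (x∙yz≈y∙xz (count (flip R? y) xs) (count (R? x) zs) (columns zs))

  -- Σₓ #{y ∣ R x y} ≥ |xs| ≥ |ys| ≥ Σ_y #{x ∣ R x y}, and the two ends are equal.
  double-counting-squeeze : ∀ {xs ys} → length ys ≤ length xs →
    (∀ {x} → x ∈ₗ xs → count (R? x) ys > 0) → (∀ {y} → y ∈ₗ ys → count (flip R? y) xs ≤ 1) →
    (∀ {x} → x ∈ₗ xs → count (R? x) ys ≡ 1) × (∀ {y} → y ∈ₗ ys → count (flip R? y) xs ≡ 1)
  double-counting-squeeze {xs} {ys} ∣ys∣≤∣xs∣ rows>0 columns≤1 =
    sym ∘ sum-map-tight rows>0 rows≤∣xs∣ , sum-map-tight columns≤1 ∣ys∣≤columns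
    where
    open ≤-Reasoning
    rows≤∣xs∣ : sum (map (λ x → count (R? x) ys) xs) ≤ sum (map (λ _ → 1) xs)
    rows≤∣xs∣ = begin
      sum (map (λ x → count (R? x) ys) xs)       ≡⟨ sum-count-swap xs ys ⟩
      sum (map (λ y → count (flip R? y) xs) ys)  ≤⟨ sum-map-mono-≤ columns≤1 ⟩
      sum (map (λ _ → 1) ys)                     ≡⟨ sum-map-one ys ⟩
      length ys                                  ≤⟨ ∣ys∣≤∣xs∣ ⟩
      length xs                                  ≡⟨ sum-map-one xs ⟨
      sum (map (λ _ → 1) xs)                     ∎
    ∣ys∣≤columns : sum (map (λ _ → 1) ys) ≤ sum (map (λ y → count (flip R? y) xs) ys)
    ∣ys∣≤columns = begin
      sum (map (λ _ → 1) ys)                     ≡⟨ sum-map-one ys ⟩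
      length ys                                  ≤⟨ ∣ys∣≤∣xs∣ ⟩
      length xs                                  ≡⟨ sum-map-one xs ⟨
      sum (map (λ _ → 1) xs)                     ≤⟨ sum-map-mono-≤ rows>0 ⟩
      sum (map (λ x → count (R? x) ys) xs)       ≡⟨ sum-count-swap xs ys ⟩
      sum (map (λ y → count (flip R? y) xs) ys)  ∎

combinations : ∀ N → ℕ → List (Subset N)
combinations zero    zero    = [ [] ]
combinations zero    (suc m) = []
combinations (suc N) zero    = map (outside ∷_) (combinations N zero)
combinations (suc N) (suc m) =
  map (outside ∷_) (combinations N (suc m)) ++ map (inside ∷_) (combinations N m)

∈-combinations⁻ : p ∈ₗ combinations N m → ∣ p ∣ ≡ m
∈-combinations⁻ {N = zero}  {m = zero}  (here refl) = refl
∈-combinations⁻ {N = suc N} {m = zero}  p∈ with ∈-map⁻ (outside ∷_) p∈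
... | _ , q∈ , refl = ∈-combinations⁻ q∈
∈-combinations⁻ {N = suc N} {m = suc m} p∈ with ∈-++⁻ (map (outside ∷_) (combinations N (suc m))) p∈
... | inj₁ p∈₁ with ∈-map⁻ (outside ∷_) p∈₁
...   | _ , q∈ , refl = ∈-combinations⁻ q∈
∈-combinations⁻ {N = suc N} {m = suc m} p∈ | inj₂ p∈₂ with ∈-map⁻ (inside ∷_) p∈₂
...   | _ , q∈ , refl = cong suc (∈-combinations⁻ q∈)

∈-combinations⁺ : ∀ (p : Subset N) → ∣ p ∣ ≡ m → p ∈ₗ combinations N m
∈-combinations⁺ {m = zero}  []            _ = here refl
∈-combinations⁺ {m = zero}  (outside ∷ p) ∣p∣≡0 = ∈-map⁺ (outside ∷_) (∈-combinations⁺ p ∣p∣≡0)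
∈-combinations⁺ {m = suc m} (outside ∷ p) ∣p∣≡1+m =
  ∈-++⁺ˡ (∈-map⁺ (outside ∷_) (∈-combinations⁺ p ∣p∣≡1+m))
∈-combinations⁺ {m = suc m} (inside ∷ p)  ∣p∣≡1+m =
  ∈-++⁺ʳ _ (∈-map⁺ (inside ∷_) (∈-combinations⁺ p (suc-injective ∣p∣≡1+m)))

private
  count-⊆-map-∷ : ∀ {s t} (A : Subset N) → (∀ {Y} → Y ⊆ A ⇔ s ∷ Y ⊆ t ∷ A) →
                  ∀ xs → count (_⊆? t ∷ A) (map (s ∷_) xs) ≡ count (_⊆? A) xs
  count-⊆-map-∷ {s = s} {t} A ⇔ xs = trans (count-map (_⊆? t ∷ A) (s ∷_) xs)
    (count-≐ (λ Y → s ∷ Y ⊆? t ∷ A) (_⊆? A) (Equivalence.from ⇔ , Equivalence.to ⇔) xs)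

count-⊆-combinations : ∀ (A : Subset N) m → count (_⊆? A) (combinations N m) ≡ ∣ A ∣ C m
count-⊆-combinations []      zero    = refl
count-⊆-combinations []      (suc m) = refl
count-⊆-combinations {suc N} (s ∷ A) zero =
  trans (count-⊆-map-∷ A out⊆-⇔ (combinations N zero)) (count-⊆-combinations A zero)
count-⊆-combinations {suc N} (outside ∷ A) (suc m) = begin
  count (_⊆? outside ∷ A) (map (outside ∷_) Cₒ ++ map (inside ∷_) Cᵢ)
    ≡⟨ count-++ (_⊆? outside ∷ A) (map (outside ∷_) Cₒ) (map (inside ∷_) Cᵢ) ⟩
  count (_⊆? outside ∷ A) (map (outside ∷_) Cₒ) + count (_⊆? outside ∷ A) (map (inside ∷_) Cᵢ)
    ≡⟨ cong₂ _+_ (count-⊆-map-∷ A out⊆-⇔ Cₒ) (count-map (_⊆? outside ∷ A) (inside ∷_) Cᵢ) ⟩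
  count (_⊆? A) Cₒ + count (λ Y → inside ∷ Y ⊆? outside ∷ A) Cᵢ
    ≡⟨ cong₂ _+_ (count-⊆-combinations A (suc m)) (cong length (filter-none (λ Y → inside ∷ Y ⊆? outside ∷ A)
                   (All.universal (λ _ ⊆ → contradiction (⊆ here) λ ()) Cᵢ))) ⟩
  ∣ A ∣ C suc m + 0
    ≡⟨ +-identityʳ (∣ A ∣ C suc m) ⟩
  ∣ A ∣ C suc m ∎
  where
  open ≡-Reasoning
  Cₒ Cᵢ : List (Subset N)
  Cₒ = combinations N (suc m)
  Cᵢ = combinations N m
count-⊆-combinations {suc N} (inside ∷ A) (suc m) = begin
  count (_⊆? inside ∷ A) (map (outside ∷_) Cₒ ++ map (inside ∷_) Cᵢ)
    ≡⟨ count-++ (_⊆? inside ∷ A) (map (outside ∷_) Cₒ) (map (inside ∷_) Cᵢ) ⟩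
  count (_⊆? inside ∷ A) (map (outside ∷_) Cₒ) + count (_⊆? inside ∷ A) (map (inside ∷_) Cᵢ)
    ≡⟨ cong₂ _+_ (count-⊆-map-∷ A out⊆-⇔ Cₒ) (count-⊆-map-∷ A in⊆in-⇔ Cᵢ) ⟩
  count (_⊆? A) Cₒ + count (_⊆? A) Cᵢ
    ≡⟨ cong₂ _+_ (count-⊆-combinations A (suc m)) (count-⊆-combinations A m) ⟩
  ∣ A ∣ C suc m + ∣ A ∣ C m
    ≡⟨ +-comm (∣ A ∣ C suc m) (∣ A ∣ C m) ⟩
  ∣ A ∣ C m + ∣ A ∣ C suc m
    ≡⟨ nCk+nC[k+1]≡[n+1]C[k+1] ∣ A ∣ m ⟩
  suc ∣ A ∣ C suc m ∎
  where
  open ≡-Reasoning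
  Cₒ Cᵢ : List (Subset N)
  Cₒ = combinations N (suc m)
  Cᵢ = combinations N m

length-combinations : ∀ N m → length (combinations N m) ≡ N C m
length-combinations N m = begin
  length (combinations N m)
    ≡⟨ cong length (filter-all (_⊆? ⊤ {N}) (All.universal (λ _ {_} → ⊆⊤) (combinations N m))) ⟨
  count (_⊆? ⊤) (combinations N m)
    ≡⟨ count-⊆-combinations (⊤ {N}) m ⟩
  ∣ ⊤ {N} ∣ C m
    ≡⟨ cong (_C m) (∣⊤∣≡n N) ⟩
  N C m ∎
  where open ≡-Reasoning

allOf : Subset N → (Fin N → Bool) → Bool
allOf []            f = true
allOf (outside ∷ s) f = allOf s (f ∘ suc)
allOf (inside ∷ s)  f = f zero ∧ allOf s (f ∘ suc)

allOf⁺ : ∀ {p : Subset N} {f : Fin N → Bool} → (∀ {x} → x ∈ p → f x ≡ true) → allOf p f ≡ true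
allOf⁺ {p = []}          _  = refl
allOf⁺ {p = outside ∷ p} f∈ = allOf⁺ (f∈ ∘ there)
allOf⁺ {p = inside ∷ p}  f∈ rewrite f∈ here = allOf⁺ (f∈ ∘ there)

allOf⁻ : ∀ {p : Subset N} {f : Fin N → Bool} → allOf p f ≡ true → x ∈ p → f x ≡ true
allOf⁻ {p = inside ∷ p}  {f} all here with f zero
... | true = refl
allOf⁻ {p = outside ∷ p}     all (there x∈p) = allOf⁻ all x∈p
allOf⁻ {p = inside ∷ p}  {f} all (there x∈p) with f zero
... | true = allOf⁻ all x∈p

-- commonOut is defined through a fold that is local to Defs and cannot be named here.
-- The left-hand sides `_` below stand for that fold: Agda infers them from the use in
-- lookup-commonOut, where the with-abstractions have made all its arguments variables.
mutual
  lookup-commonOut : ∀ D S y → lookup (commonOut D S) y ≡ allOf S (λ x → arc D x y)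
  lookup-commonOut D S y = trans (lookup∘tabulate _ y) (unfold-commonOut D S y)

  private
    unfold-commonOut : ∀ D (S : Subset (n D)) y → _ ≡ allOf S (λ x → arc D x y)
    unfold-commonOut record { n = suc N ; arc = a ; noLoop = nl } (outside ∷ S) y
      with suc N | a | nl | outside ∷ S | (λ x → a (suc x) y)
    ... | N′ | a′ | nl′ | P | f = fold≡allOf (record { n = N′ ; arc = a′ ; noLoop = nl′ }) P S f
    unfold-commonOut record { n = suc N ; arc = a ; noLoop = nl } (inside ∷ S) y with a zero y
    ... | b with suc N | a | nl | inside ∷ S | (λ x → a (suc x) y)
    ...   | N′ | a′ | nl′ | P | f =
      cong (b ∧_) (fold≡allOf (record { n = N′ ; arc = a′ ; noLoop = nl′ }) P S f)

    fold≡allOf : ∀ D (P : Subset (n D)) (s : Subset N) f → _ ≡ allOf s f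
    fold≡allOf D P []            f = refl
    fold≡allOf D P (outside ∷ s) f = fold≡allOf D P s (f ∘ suc)
    fold≡allOf D P (inside ∷ s)  f = cong (f zero ∧_) (fold≡allOf D P s (f ∘ suc))

IsComplete : Digraph → Set
IsComplete D = ∀ {x y} → x ≢ y → arc D x y ≡ true

module CommonNeighbours (D : Digraph) where

  commonIn : Subset (n D) → Subset (n D)
  commonIn Y = tabulate λ x → allOf Y (arc D x)

  ∈-commonOut⁺ : ∀ S {y} → (∀ {x} → x ∈ S → arc D x y ≡ true) → y ∈ commonOut D S
  ∈-commonOut⁺ S {y} arcs = lookup⇒[]= y _ (trans (lookup-commonOut D S y) (allOf⁺ arcs))

  ∈-commonOut⁻ : ∀ S {x y} → y ∈ commonOut D S → x ∈ S → arc D x y ≡ true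
  ∈-commonOut⁻ S {y = y} y∈ = allOf⁻ (trans (sym (lookup-commonOut D S y)) ([]=⇒lookup y∈))

  ∈-commonIn⁺ : ∀ Y {x} → (∀ {y} → y ∈ Y → arc D x y ≡ true) → x ∈ commonIn Y
  ∈-commonIn⁺ Y {x} arcs = lookup⇒[]= x _ (trans (lookup∘tabulate _ x) (allOf⁺ arcs))

  ∈-commonIn⁻ : ∀ Y {x y} → x ∈ commonIn Y → y ∈ Y → arc D x y ≡ true
  ∈-commonIn⁻ Y {x} x∈ = allOf⁻ (trans (sym (lookup∘tabulate _ x)) ([]=⇒lookup x∈))

  ⊆-commonOut⇒⊆-commonIn : ∀ S Y → Y ⊆ commonOut D S → S ⊆ commonIn Y
  ⊆-commonOut⇒⊆-commonIn S Y Y⊆ x∈S = ∈-commonIn⁺ Y λ y∈Y → ∈-commonOut⁻ S (Y⊆ y∈Y) x∈S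

  ⊆-commonIn⇒⊆-commonOut : ∀ S Y → S ⊆ commonIn Y → Y ⊆ commonOut D S
  ⊆-commonIn⇒⊆-commonOut S Y S⊆ y∈Y = ∈-commonOut⁺ S λ x∈S → ∈-commonIn⁻ Y (S⊆ x∈S) y∈Y

  commonOut-∪⊆ : ∀ T U → commonOut D (T ∪ U) ⊆ commonOut D T
  commonOut-∪⊆ T U y∈ = ∈-commonOut⁺ T λ x∈T → ∈-commonOut⁻ (T ∪ U) y∈ (p⊆p∪q U x∈T)

  commonOut-disjoint : ∀ S {y} → y ∈ commonOut D S → y ∉ S
  commonOut-disjoint S {y} y∈ y∈S with () ← trans (sym (∈-commonOut⁻ S y∈ y∈S)) (noLoop D y)

  commonOut⊆∁ : ∀ S → commonOut D S ⊆ ∁ S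
  commonOut⊆∁ S = x∉p⇒x∈∁p ∘ commonOut-disjoint S

  ∁⊆commonOut : IsComplete D → ∀ S → ∁ S ⊆ commonOut D S
  ∁⊆commonOut complete S y∈∁S =
    ∈-commonOut⁺ S λ x∈S → complete λ x≡y → x∈∁p⇒x∉p y∈∁S (subst (_∈ S) x≡y x∈S)

  commonOut-∪⁅⁆⊂ : ∀ T {x} → x ∈ commonOut D T → commonOut D (T ∪ ⁅ x ⁆) ⊂ commonOut D T
  commonOut-∪⁅⁆⊂ T {x} x∈ =
    commonOut-∪⊆ T ⁅ x ⁆ , x , x∈ ,
    λ x∈′ → commonOut-disjoint (T ∪ ⁅ x ⁆) x∈′ (q⊆p∪q T ⁅ x ⁆ (x∈⁅x⁆ x))

module Liking (D : Digraph) {k l : ℕ} (t≤V : suc k ≤ n D)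
              (liking : ∀ S → ∣ S ∣ ≡ suc k → ∣ commonOut D S ∣ ≡ l) where

  open CommonNeighbours D

  private
    V : ℕ
    V = n D

    t-set : ∃[ S ] ∣ S ∣ ≡ suc k
    t-set = ∃-of-size t≤V

    S₀ : Subset V
    S₀ = proj₁ t-set

    ∣S₀∣ : ∣ S₀ ∣ ≡ suc k
    ∣S₀∣ = proj₂ t-set

    ∣∁S₀∣ : ∣ ∁ S₀ ∣ ≡ V ∸ suc k
    ∣∁S₀∣ = trans (∣∁p∣≡n∸∣p∣ S₀) (cong (V ∸_) ∣S₀∣)

  liking-∪⁅⁆ : ∀ T {x} → ∣ T ∣ ≡ k → x ∉ T → ∣ commonOut D (T ∪ ⁅ x ⁆) ∣ ≡ l
  liking-∪⁅⁆ T {x} ∣T∣≡k x∉T = liking (T ∪ ⁅ x ⁆) (trans (∣p∪⁅x⁆∣≡1+∣p∣ x∉T) (cong suc ∣T∣≡k))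

  l≤V∸t : l ≤ V ∸ suc k
  l≤V∸t = begin
    l                     ≡⟨ liking S₀ ∣S₀∣ ⟨
    ∣ commonOut D S₀ ∣    ≤⟨ p⊆q⇒∣p∣≤∣q∣ (commonOut⊆∁ S₀) ⟩
    ∣ ∁ S₀ ∣              ≡⟨ ∣∁S₀∣ ⟩
    V ∸ suc k             ∎
    where open ≤-Reasoning

  -- The lost neighbour x is a common out-neighbour of the t-set T ∪ {w}, for any w ∉ T.
  l<∣commonOut∣ : l > 0 → ∀ T → ∣ T ∣ ≡ k → l < ∣ commonOut D T ∣
  l<∣commonOut∣ l>0 T ∣T∣≡k =
    let w , w∉T = ∣p∣<N⇒∃∉ {p = T} (subst (_< V) (sym ∣T∣≡k) t≤V)
        x , x∈ = ∣p∣>0⇒nonempty {p = commonOut D (T ∪ ⁅ w ⁆)}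
                   (subst (_> 0) (sym (liking-∪⁅⁆ T ∣T∣≡k w∉T)) l>0)
        x∈N⁺T = commonOut-∪⊆ T ⁅ w ⁆ x∈
    in begin-strict
      l                                ≡⟨ liking-∪⁅⁆ T ∣T∣≡k (commonOut-disjoint T x∈N⁺T) ⟨
      ∣ commonOut D (T ∪ ⁅ x ⁆) ∣       <⟨ p⊂q⇒∣p∣<∣q∣ (commonOut-∪⁅⁆⊂ T x∈N⁺T) ⟩
      ∣ commonOut D T ∣                 ∎
    where open ≤-Reasoning

  ∣commonIn∣≤k : ∀ Y → l < ∣ Y ∣ → ∣ commonIn Y ∣ ≤ k
  ∣commonIn∣≤k Y l<∣Y∣ = ≮⇒≥ λ k<∣N⁻Y∣ →
    let S , S⊆N⁻Y , ∣S∣≡t = subset-of-size (commonIn Y) k<∣N⁻Y∣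
    in <-irrefl refl (begin-strict
      l                    <⟨ l<∣Y∣ ⟩
      ∣ Y ∣                ≤⟨ p⊆q⇒∣p∣≤∣q∣ (⊆-commonIn⇒⊆-commonOut S Y S⊆N⁻Y) ⟩
      ∣ commonOut D S ∣    ≡⟨ liking S ∣S∣≡t ⟩
      l                    ∎)
    where open ≤-Reasoning

  module _ (l>0 : l > 0) (l<k : l < k) where

    private
      R? : Decidable₂ (λ T Y → Y ⊆ commonOut D T)
      R? T Y = Y ⊆? commonOut D T

      count-commonIn : ∀ Y → count (flip R? Y) (combinations V k) ≡ ∣ commonIn Y ∣ C k
      count-commonIn Y = trans
        (count-≐ (flip R? Y) (_⊆? commonIn Y)
                 ((λ {S} → ⊆-commonOut⇒⊆-commonIn S Y) , (λ {S} → ⊆-commonIn⇒⊆-commonOut S Y))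
                 (combinations V k))
        (count-⊆-combinations (commonIn Y) k)

      ∣Ys∣≤∣Ts∣ : length (combinations V (suc l)) ≤ length (combinations V k)
      ∣Ys∣≤∣Ts∣ = begin
        length (combinations V (suc l))  ≡⟨ length-combinations V (suc l) ⟩
        V C suc l                        ≤⟨ nCi≤nCj l<k 1+l+k≤V ⟩
        V C k                            ≡⟨ length-combinations V k ⟨
        length (combinations V k)        ∎
        where
        open ≤-Reasoning
        1+l+k≤V : suc l + k ≤ V
        1+l+k≤V = begin
          suc l + k            ≡⟨ cong suc (+-comm l k) ⟩
          suc k + l            ≤⟨ +-monoʳ-≤ (suc k) l≤V∸t ⟩
          suc k + (V ∸ suc k)  ≡⟨ m+[n∸m]≡n t≤V ⟩
          V                    ∎

      exactly-one : (∀ {T} → T ∈ₗ combinations V k → count (R? T) (combinations V (suc l)) ≡ 1) ×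
                    (∀ {Y} → Y ∈ₗ combinations V (suc l) → count (flip R? Y) (combinations V k) ≡ 1)
      exactly-one = double-counting-squeeze R? ∣Ys∣≤∣Ts∣
        (λ {T} T∈ → subst (_> 0) (sym (count-⊆-combinations (commonOut D T) (suc l)))
                      (k≤n⇒nCk>0 (l<∣commonOut∣ l>0 T (∈-combinations⁻ T∈))))
        (λ {Y} Y∈ → subst (_≤ 1) (sym (count-commonIn Y))
                      (n≤k⇒nCk≤1 (∣commonIn∣≤k Y (≤-reflexive (sym (∈-combinations⁻ Y∈))))))

    ∣commonOut∣≤1+l : ∀ T → ∣ T ∣ ≡ k → ∣ commonOut D T ∣ ≤ suc l
    ∣commonOut∣≤1+l T ∣T∣≡k = nCk≡1⇒n≤k z<s
      (trans (sym (count-⊆-combinations (commonOut D T) (suc l)))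
             (proj₁ exactly-one (∈-combinations⁺ T ∣T∣≡k)))

    k≤∣commonIn∣ : ∀ Y → ∣ Y ∣ ≡ suc l → k ≤ ∣ commonIn Y ∣
    k≤∣commonIn∣ Y ∣Y∣≡1+l = nCk>0⇒k≤n
      (subst (_> 0) (trans (sym (proj₂ exactly-one (∈-combinations⁺ Y ∣Y∣≡1+l))) (count-commonIn Y)) z<s)

    commonOut-complete : ∀ T {x z} → ∣ T ∣ ≡ k → x ∈ commonOut D T → z ∈ commonOut D T → x ≢ z →
                         arc D x z ≡ true
    commonOut-complete T {x} {z} ∣T∣≡k x∈N⁺T z∈N⁺T x≢z = ¬-not λ x↛z → <-irrefl refl (begin-strict
      suc l                          ≡⟨ cong suc (liking-∪⁅⁆ T ∣T∣≡k (commonOut-disjoint T x∈N⁺T)) ⟨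
      suc ∣ commonOut D S ∣          ≡⟨ ∣p∪⁅x⁆∣≡1+∣p∣ (z∉N⁺S x↛z) ⟨
      ∣ commonOut D S ∪ ⁅ z ⁆ ∣      <⟨ p⊂q⇒∣p∣<∣q∣ (p∪⁅y⁆⊂q (commonOut-∪⊆ T ⁅ x ⁆) z∈N⁺T x∈N⁺T
                                                             (λ x∈N⁺S → commonOut-disjoint S x∈N⁺S x∈S) x≢z) ⟩
      ∣ commonOut D T ∣              ≤⟨ ∣commonOut∣≤1+l T ∣T∣≡k ⟩
      suc l                          ∎)
      where
      open ≤-Reasoning
      S : Subset V
      S = T ∪ ⁅ x ⁆
      x∈S : x ∈ S
      x∈S = q⊆p∪q T ⁅ x ⁆ (x∈⁅x⁆ x)
      z∉N⁺S : arc D x z ≡ false → z ∉ commonOut D S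
      z∉N⁺S x↛z z∈ with () ← trans (sym (∈-commonOut⁻ S z∈ x∈S)) x↛z

    arc-complete : IsComplete D
    arc-complete {x} {z} x≢z =
      let Y , xz⊆Y , ∣Y∣≡1+l = superset-of-size (⁅ x ⁆ ∪ ⁅ z ⁆) ∣xz∣≤1+l 1+l≤V
          T , T⊆N⁻Y , ∣T∣≡k = subset-of-size (commonIn Y) (k≤∣commonIn∣ Y ∣Y∣≡1+l)
          Y⊆N⁺T = ⊆-commonIn⇒⊆-commonOut T Y T⊆N⁻Y
      in commonOut-complete T ∣T∣≡k (Y⊆N⁺T (xz⊆Y (p⊆p∪q ⁅ z ⁆ (x∈⁅x⁆ x))))
                                     (Y⊆N⁺T (xz⊆Y (q⊆p∪q ⁅ x ⁆ ⁅ z ⁆ (x∈⁅x⁆ z)))) x≢z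
      where
      open ≤-Reasoning
      ∣xz∣≤1+l : ∣ ⁅ x ⁆ ∪ ⁅ z ⁆ ∣ ≤ suc l
      ∣xz∣≤1+l = begin
        ∣ ⁅ x ⁆ ∪ ⁅ z ⁆ ∣   ≡⟨ ∣p∪⁅x⁆∣≡1+∣p∣ (x≢y⇒x∉⁅y⁆ (x≢z ∘ sym)) ⟩
        suc ∣ ⁅ x ⁆ ∣       ≡⟨ cong suc (∣⁅x⁆∣≡1 x) ⟩
        2                   ≤⟨ s≤s l>0 ⟩
        suc l               ∎
      1+l≤V : suc l ≤ V
      1+l≤V = ≤-trans l<k (≤-trans (n≤1+n k) t≤V)

    V≡t+l : n D ≡ suc k + l
    V≡t+l = begin
      V                    ≡⟨ m+[n∸m]≡n t≤V ⟨
      suc k + (V ∸ suc k)  ≡⟨ cong (suc k +_) (≤-antisym V∸t≤l l≤V∸t) ⟩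
      suc k + l            ∎
      where
      open ≡-Reasoning
      V∸t≤l : V ∸ suc k ≤ l
      V∸t≤l = ≤-trans (≤-reflexive (sym ∣∁S₀∣))
                (≤-trans (p⊆q⇒∣p∣≤∣q∣ (∁⊆commonOut arc-complete S₀)) (≤-reflexive (liking S₀ ∣S₀∣)))

≅-complete : ∀ D → IsComplete D → D ≅ complete (n D)
≅-complete D complete-D = ⤖-id (Fin (n D)) , arcs
  where
  arcs : ∀ x y → arc D x y ≡ arc (complete (n D)) x y
  arcs x y with x ≟ y
  ... | yes refl = noLoop D x
  ... | no x≢y   = complete-D x≢y

theorem1p1 : (t l : ℕ) → 1 ≤ t → 1 ≤ l → suc (suc l) ≤ t →
    (D : Digraph) → IsLiking t l D → D ≅ complete (t + l)
theorem1p1 (suc k) l _ l>0 (s≤s l<k) D (t≤V , liking) =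
  subst (λ V → D ≅ complete V) (V≡t+l l>0 l<k) (≅-complete D (arc-complete l>0 l<k))
  where open Liking D t≤V liking
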